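{- Let $k$ be a positive integer. There is a partition of the set of all (finite) matroids into blocks $P_1,\ldots,P_{N_1(k)}$ with $N_1(k)\le f_1(k)$ such that the following holds: for every sentence $\psi$ of $\mathit{MS}_0$ with $k$ variables, whenever $M$ and $M'$ are matroids in the same block, then for every matroid $M''$ (with ground set disjoint from those of $M$ and $M'$), either $M\oplus M''$ and $M'\oplus M''$ both satisfy $\psi$, or neither satisfies $\psi$.
   Context: All matroids are finite; $M\oplus M''$ denotes the direct sum of matroids with disjoint ground sets. For a positive integer $k$, let $g_1(k,0)=3^k2^{k(k+1)}$, $g_1(k,i+1)=2^{g_1(k,i)}$, and $f_1(k)=g_1(k,k)$. $\mathit{MS}_0$ is the following monadic second-order language for matroids. It has variables $X_1,X_2,\ldots$, atomic formulas $X_i\subseteq X_j$, $\mathrm{Sing}(X_i)$, $\mathrm{Ind}(X_i)$, connectives $\neg,\land$ and quantifiers $\exists,\forall$. Formulas $\psi$, with variable sets $\mathrm{Var}(\psi)$ and free-variable sets $\mathrm{Fr}(\psi)$, are built recursively: an atomic formula has $\mathrm{Fr}=\mathrm{Var}=$ the variables occurring in it; $\neg\psi$ has the same $\mathrm{Var},\mathrm{Fr}$ as $\psi$; $\psi_1\land\psi_2$ is a formula provided $\mathrm{Fr}(\psi_i)\cap(\mathrm{Var}(\psi_j)-\mathrm{Fr}(\psi_j))=\emptyset$ for $\{i,j\}=\{1,2\}$, with $\mathrm{Var},\mathrm{Fr}$ the unions; if $X_i\in\mathrm{Fr}(\psi)$ then $\exists X_i\,\psi$ and $\forall X_i\,\psi$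 are formulas with variable set $\mathrm{Var}(\psi)$ and free-variable set $\mathrm{Fr}(\psi)-\{X_i\}$. A sentence is a formula with no free variables; it has $k$ variables if $|\mathrm{Var}(\psi)|=k$. A matroid $M$ satisfies a sentence if it is true when variables range over subsets of $E(M)$, $\subseteq$ is containment, $\mathrm{Sing}(X)$ means $|X|=1$, and $\mathrm{Ind}(X)$ means $X$ is independent in $M$. -}

module Defs where

open import Data.Nat using (ℕ; zero; suc; _+_; _*_; _^_; _≟_)
open import Data.Bool using (Bool; true; false; _∧_)
open import Data.Fin using (Fin)
open import Data.Fin.Subset using (Subset; _⊆_; _∈_; _∉_; ∣_∣; _∪_; ⁅_⁆)
open import Data.Vec using (Vec; take; drop)
open import Data.List using (List; []; _∷_; _++_; filter; length; deduplicate)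
open import Data.List.Membership.Propositional using () renaming (_∈_ to _∈ₗ_)
open import Data.Product using (Σ; _×_; _,_)
open import Relation.Nullary using (¬_; ¬?; yes; no)
open import Data.Unit using (⊤)
open import Relation.Binary.PropositionalEquality using (_≡_)
open import Data.Nat.Base using (_<_)

g₁ : ℕ → ℕ → ℕ
g₁ k zero = 3 ^ k * 2 ^ (k * (k + 1))
g₁ k (suc i) = 2 ^ g₁ k i

f₁ : ℕ → ℕ
f₁ k = g₁ k k

-- Finite matroids.  A matroid on ground set Fin n is given by the
-- (Boolean) indicator of its independent sets, subject to the usual
-- independence axioms (I1)-(I3).

IsMatroid : (n : ℕ) → (Subset n → Bool) → Set
IsMatroid n ind =
  (ind Data.Fin.Subset.⊥ ≡ true)
  × (∀ X Y → X ⊆ Y → ind Y ≡ true → ind X ≡ true)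
  × (∀ X Y → ind X ≡ true → ind Y ≡ true → ∣ X ∣ < ∣ Y ∣ →
       Σ (Fin n) λ e → (e ∈ Y) × (e ∉ X) × (ind (X ∪ ⁅ e ⁆) ≡ true))

-- Direct sum: ground set Fin (n + m), the first n elements being the
-- ground set of the first summand and the last m those of the second
-- (so the ground sets are disjoint).
_⊕_ : {n m : ℕ} → (Subset n → Bool) → (Subset m → Bool) → Subset (n + m) → Bool
_⊕_ {n} {m} I J X = I (take n X) ∧ J (drop n X)

data Formula : Set where
  sub  : ℕ → ℕ → Formula
  sing : ℕ → Formula
  ind  : ℕ → Formula
  neg  : Formula → Formula
  and  : Formula → Formula → Formula
  ex   : ℕ → Formula → Formula
  all  : ℕ → Formula → Formula

-- Var(ψ) and Fr(ψ) as lists (possibly with repetitions)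
vars : Formula → List ℕ
vars (sub i j) = i ∷ j ∷ []
vars (sing i) = i ∷ []
vars (ind i) = i ∷ []
vars (neg φ) = vars φ
vars (and φ χ) = vars φ ++ vars χ
vars (ex i φ) = vars φ
vars (all i φ) = vars φ

free : Formula → List ℕ
free (sub i j) = i ∷ j ∷ []
free (sing i) = i ∷ []
free (ind i) = i ∷ []
free (neg φ) = free φ
free (and φ χ) = free φ ++ free χ
free (ex i φ) = filter (λ x → ¬? (x ≟ i)) (free φ)
free (all i φ) = filter (λ x → ¬? (x ≟ i)) (free φ)

Compat : Formula → Formula → Set
Compat φ χ = ∀ x → x ∈ₗ free φ → x ∈ₗ vars χ → x ∈ₗ free χ

WellFormed : Formula → Set
WellFormed (sub i j) = ⊤
WellFormed (sing i) = ⊤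
WellFormed (ind i) = ⊤
WellFormed (neg φ) = WellFormed φ
WellFormed (and φ χ) = WellFormed φ × WellFormed χ × Compat φ χ × Compat χ φ
WellFormed (ex i φ) = WellFormed φ × (i ∈ₗ free φ)
WellFormed (all i φ) = WellFormed φ × (i ∈ₗ free φ)

IsSentence : Formula → Set
IsSentence ψ = WellFormed ψ × (free ψ ≡ [])

numVars : Formula → ℕ
numVars ψ = length (deduplicate _≟_ (vars ψ))

update : {n : ℕ} → (ℕ → Subset n) → ℕ → Subset n → ℕ → Subset n
update ρ i S x with x ≟ i
... | yes _ = S
... | no _ = ρ x

Sat : (n : ℕ) → (Subset n → Bool) → (ℕ → Subset n) → Formula → Set
Sat n I ρ (sub i j) = ρ i ⊆ ρ j
Sat n I ρ (sing i) = ∣ ρ i ∣ ≡ 1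
Sat n I ρ (ind i) = I (ρ i) ≡ true
Sat n I ρ (neg φ) = ¬ Sat n I ρ φ
Sat n I ρ (and φ χ) = Sat n I ρ φ × Sat n I ρ χ
Sat n I ρ (ex i φ) = Σ (Subset n) λ S → Sat n I (update ρ i S) φ
Sat n I ρ (all i φ) = (S : Subset n) → Sat n I (update ρ i S) φ

Models : (n : ℕ) → (Subset n → Bool) → Formula → Set
Models n I ψ = Sat n I (λ _ → Data.Fin.Subset.⊥) ψ

-- Ehrenfeucht–Fraïssé types.  Fix k slots for the set variables and define the depth-r type of
-- an assignment θ of subsets to the slots: at depth 0 it records, for every slot, the size of its
-- set capped at 2, its independence, and which other slots contain it; at depth r + 1 it is the
-- set of depth-r types obtained by reassigning slot r.  Equal depth-R types force every formula of
-- quantifier depth at most R to have the same truth value, and types are compositional: the type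
-- of a direct sum with an assignment split across the summands depends only on the types of the
-- two parts.  A sentence with k variables has quantifier depth at most k, since well-formedness
-- prevents a variable from being rebound inside its own scope, so the depth-k type of the empty
-- assignment is the required block; there are g₁ k k = f₁ k of them.
module Submission where

open import Defs
open import Data.Bool using (Bool; _∧_)
open import Data.Empty using (⊥-elim)
open import Data.Fin using (Fin; zero; toℕ; fromℕ<; combine; remQuot; splitAt; _↑ˡ_; _↑ʳ_; funToFin; finToFun)
  renaming (_≟_ to _≟ᶠ_)
open import Data.Fin.Patterns using (0F; 1F; 2F)
open import Data.Fin.Properties using (2↔Bool; finToFun-funToFin; remQuot-combine; combine-injectiveˡ; combine-injectiveʳ; splitAt-↑ˡ; splitAt-↑ʳ; toℕ-fromℕ<)
open import Data.Fin.Subset using (Subset; ∣_∣; inside; outside) renaming (⊥ to ∅)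
open import Data.Fin.Subset.Properties using (_⊆?_; anySubset?)
open import Data.List using (List; []; _∷_; length; filter) renaming (_++_ to _++ₗ_)
open import Data.List.Membership.Propositional using () renaming (_∈_ to _∈ₗ_; _∉_ to _∉ₗ_)
open import Data.List.Membership.Propositional.Properties using (∈-++⁺ˡ; ∈-++⁺ʳ; ∈-++⁻; ∈-∃++; ∈-filter⁺; ∈-filter⁻; ∈-deduplicate⁺)
open import Data.List.Relation.Binary.Permutation.Propositional.Properties using (↭-length; shift)
open import Data.List.Relation.Unary.All as All using (lookup)
open import Data.List.Relation.Unary.Any using (here; there)
open import Data.List.Relation.Unary.Unique.Propositional using (Unique; []; _∷_)
open import Data.Nat using (ℕ; zero; suc; _+_; _*_; _^_; _≤_; _<_; _⊔_; z≤n; s≤s; _≟_)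
open import Data.Nat.Properties using (≤-refl; ≤-trans; ≤-total; <⇒≤; >⇒≢; ⊔-lub; m⊔n≤o⇒m≤o; m⊔n≤o⇒n≤o)
open import Data.Product using (Σ; ∃-syntax; _×_; _,_; proj₁; proj₂; uncurry)
open import Data.Product.Function.NonDependent.Propositional using (_×-⇔_)
open import Data.Sum using (_⊎_; inj₁; inj₂; [_,_]′)
open import Data.Vec using (_∷_; []; _++_; take; drop)
open import Data.Vec.Properties using (take++drop≡id; ++-injective)
open import Function using (id; _∘_; const)
open import Function.Bundles using (_⇔_; mk⇔; Equivalence; Inverse)
open import Function.Related.TypeIsomorphisms using (¬-cong-⇔)
open import Relation.Binary.PropositionalEquality using (_≡_; _≢_; _≗_; refl; sym; trans; cong; cong₂; subst; subst₂; module ≡-Reasoning)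
open import Relation.Nullary using (Dec; yes; no; does; ¬?)
open import Relation.Nullary.Decidable using (does-⇔)

open Equivalence using (to; from)

private
  variable
    A B : Set
    n n′ m r R a b x : ℕ

Indep : ℕ → Set
Indep n = Subset n → Bool

Assignment : ℕ → Set
Assignment n = ℕ → Subset n

funToFin-cong : {f g : Fin m → Fin n} → f ≗ g → funToFin f ≡ funToFin g
funToFin-cong {zero}  _   = refl
funToFin-cong {suc m} f≗g = cong₂ combine (f≗g zero) (funToFin-cong (f≗g ∘ Data.Fin.suc))

funToFin-injective : {f g : Fin m → Fin n} → funToFin f ≡ funToFin g → f ≗ g
funToFin-injective {f = f} {g} e i = begin
  f i                          ≡⟨ finToFun-funToFin f i ⟨
  finToFun (funToFin f) i      ≡⟨ cong (λ c → finToFun c i) e ⟩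
  finToFun (funToFin g) i      ≡⟨ finToFun-funToFin g i ⟩
  g i                          ∎
  where open ≡-Reasoning

encodeBits : (Fin m → Bool) → Fin (2 ^ m)
encodeBits f = funToFin (Inverse.from 2↔Bool ∘ f)

encodeBits-cong : {f g : Fin m → Bool} → f ≗ g → encodeBits f ≡ encodeBits g
encodeBits-cong f≗g = funToFin-cong (cong (Inverse.from 2↔Bool) ∘ f≗g)

encodeBits-injective : {f g : Fin m → Bool} → encodeBits f ≡ encodeBits g → f ≗ g
encodeBits-injective {f = f} {g} e i = begin
  f i                                      ≡⟨ Inverse.strictlyInverseˡ 2↔Bool (f i) ⟨
  Inverse.to 2↔Bool (Inverse.from 2↔Bool (f i)) ≡⟨ cong (Inverse.to 2↔Bool) (funToFin-injective e i) ⟩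
  Inverse.to 2↔Bool (Inverse.from 2↔Bool (g i)) ≡⟨ Inverse.strictlyInverseˡ 2↔Bool (g i) ⟩
  g i                                      ∎
  where open ≡-Reasoning

encodeTable : (Fin m → Fin n → Bool) → Fin (2 ^ (m * n))
encodeTable {n = n} t = encodeBits (uncurry t ∘ remQuot n)

encodeTable-cong : {t u : Fin m → Fin n → Bool} → (∀ i j → t i j ≡ u i j) → encodeTable t ≡ encodeTable u
encodeTable-cong {n = n} t≡u = encodeBits-cong (uncurry t≡u ∘ remQuot n)

encodeTable-injective : {t u : Fin m → Fin n → Bool} → encodeTable t ≡ encodeTable u → ∀ i j → t i j ≡ u i j
encodeTable-injective {n = n} {t} {u} e i j = begin
  t i j                              ≡⟨ cong (uncurry t) (remQuot-combine i j) ⟨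
  uncurry t (remQuot n (combine i j)) ≡⟨ encodeBits-injective e (combine i j) ⟩
  uncurry u (remQuot n (combine i j)) ≡⟨ cong (uncurry u) (remQuot-combine i j) ⟩
  u i j                              ∎
  where open ≡-Reasoning

does-≡⇒⇔ : (a? : Dec A) (b? : Dec B) → does a? ≡ does b? → A ⇔ B
does-≡⇒⇔ (yes a) (yes b) _  = mk⇔ (const b) (const a)
does-≡⇒⇔ (no ¬a) (no ¬b) _  = mk⇔ (⊥-elim ∘ ¬a) (⊥-elim ∘ ¬b)
does-≡⇒⇔ (yes _) (no _)  ()
does-≡⇒⇔ (no _)  (yes _) ()

∣++∣ : (p : Subset n) (q : Subset m) → ∣ p ++ q ∣ ≡ ∣ p ∣ + ∣ q ∣
∣++∣ []            q = refl
∣++∣ (inside ∷ p)  q = cong suc (∣++∣ p q)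
∣++∣ (outside ∷ p) q = ∣++∣ p q

⊆?-++ : (p p′ : Subset n) (q q′ : Subset m) → does (p ++ q ⊆? p′ ++ q′) ≡ does (p ⊆? p′) ∧ does (q ⊆? q′)
⊆?-++ []            []             q q′ = refl
⊆?-++ (outside ∷ p) (_ ∷ p′)       q q′ = ⊆?-++ p p′ q q′
⊆?-++ (inside ∷ p)  (outside ∷ p′) q q′ = refl
⊆?-++ (inside ∷ p)  (inside ∷ p′)  q q′ = ⊆?-++ p p′ q q′

⊕-++ : (I : Indep n) (J : Indep m) (p : Subset n) (q : Subset m) → (I ⊕ J) (p ++ q) ≡ I p ∧ J q
⊕-++ {n} I J p q = cong₂ (λ X Y → I X ∧ J Y) (proj₁ split) (proj₂ split)
  where
    split : take n (p ++ q) ≡ p × drop n (p ++ q) ≡ q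
    split = ++-injective (take n (p ++ q)) p (take++drop≡id n (p ++ q))

sizeClass : ℕ → Fin 3
sizeClass 0             = 0F
sizeClass 1             = 1F
sizeClass (suc (suc _)) = 2F

sizeClass-+ : (x x′ y : ℕ) → sizeClass x ≡ sizeClass x′ → sizeClass (x + y) ≡ sizeClass (x′ + y)
sizeClass-+ 0             0              _ _  = refl
sizeClass-+ 1             1              _ _  = refl
sizeClass-+ (suc (suc _)) (suc (suc _))  _ _  = refl
sizeClass-+ 0             1              _ ()
sizeClass-+ 0             (suc (suc _))  _ ()
sizeClass-+ 1             0              _ ()
sizeClass-+ 1             (suc (suc _))  _ ()
sizeClass-+ (suc (suc _)) 0              _ ()
sizeClass-+ (suc (suc _)) 1              _ ()

sizeClass-≡1 : (x y : ℕ) → sizeClass x ≡ sizeClass y → x ≡ 1 → y ≡ 1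
sizeClass-≡1 1 1             _  _ = refl
sizeClass-≡1 1 0             () refl
sizeClass-≡1 1 (suc (suc _)) () refl

record AtomsAgree (I : Indep n) (X Y : Subset n) (I′ : Indep n′) (X′ Y′ : Subset n′) : Set where
  field
    size  : sizeClass ∣ X ∣ ≡ sizeClass ∣ X′ ∣
    indep : I X ≡ I′ X′
    incl  : does (X ⊆? Y) ≡ does (X′ ⊆? Y′)

_++ₑ_ : Assignment n → Assignment m → Assignment (n + m)
(θ ++ₑ ν) x = θ x ++ ν x

update-same : (ρ : Assignment n) (i : ℕ) (S : Subset n) → update ρ i S i ≡ S
update-same ρ i S with i ≟ i
... | yes _   = refl
... | no i≢i = ⊥-elim (i≢i refl)

update-other : (ρ : Assignment n) {i : ℕ} (S : Subset n) → x ≢ i → update ρ i S x ≡ ρ x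
update-other {x = x} ρ {i} S x≢i with x ≟ i
... | yes x≡i = ⊥-elim (x≢i x≡i)
... | no _    = refl

update-++ₑ : {ξ : Assignment (n + m)} {θ : Assignment n} {ν : Assignment m}
             {Y : Subset (n + m)} {Y₁ : Subset n} {Y₂ : Subset m} →
             ξ ≗ θ ++ₑ ν → Y ≡ Y₁ ++ Y₂ → update ξ r Y ≗ update θ r Y₁ ++ₑ update ν r Y₂
update-++ₑ {r = r} ξ≗ Y≡ x with x ≟ r
... | yes _ = Y≡
... | no _  = ξ≗ x

_[_↦_] : (ℕ → ℕ) → ℕ → ℕ → ℕ → ℕ
(σ [ i ↦ s ]) x with x ≟ i
... | yes _ = s
... | no _  = σ x

Unique-⊆⇒length≤ : {xs ys : List A} → Unique xs → (∀ {x} → x ∈ₗ xs → x ∈ₗ ys) → length xs ≤ length ys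
Unique-⊆⇒length≤ [] _ = z≤n
Unique-⊆⇒length≤ {xs = x ∷ xs} (x∉xs ∷ u) xs⊆ys with us , vs , refl ← ∈-∃++ (xs⊆ys (here refl)) =
  subst (suc (length xs) ≤_) (sym (↭-length (shift x us vs))) (s≤s (Unique-⊆⇒length≤ u drop-x))
  where
    drop-x : ∀ {y} → y ∈ₗ xs → y ∈ₗ us ++ₗ vs
    drop-x y∈ with ∈-++⁻ us (xs⊆ys (there y∈))
    ... | inj₁ y∈us         = ∈-++⁺ˡ y∈us
    ... | inj₂ (here y≡x)   = ⊥-elim (lookup x∉xs y∈ (sym y≡x))
    ... | inj₂ (there y∈vs) = ∈-++⁺ʳ us y∈vs

qdepth : Formula → ℕ
qdepth (sub _ _) = 0
qdepth (sing _)  = 0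
qdepth (ind _)   = 0
qdepth (neg φ)   = qdepth φ
qdepth (and φ χ) = qdepth φ ⊔ qdepth χ
qdepth (ex _ φ)  = suc (qdepth φ)
qdepth (all _ φ) = suc (qdepth φ)

free⊆vars : ∀ φ {x} → x ∈ₗ free φ → x ∈ₗ vars φ
free⊆vars (sub _ _) x∈ = x∈
free⊆vars (sing _)  x∈ = x∈
free⊆vars (ind _)   x∈ = x∈
free⊆vars (neg φ)   x∈ = free⊆vars φ x∈
free⊆vars (and φ χ) x∈ = [ ∈-++⁺ˡ ∘ free⊆vars φ , ∈-++⁺ʳ (vars φ) ∘ free⊆vars χ ]′ (∈-++⁻ (free φ) x∈)
free⊆vars (ex i φ)  x∈ = free⊆vars φ (proj₁ (∈-filter⁻ (λ x → ¬? (x ≟ i)) {xs = free φ} x∈))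
free⊆vars (all i φ) x∈ = free⊆vars φ (proj₁ (∈-filter⁻ (λ x → ¬? (x ≟ i)) {xs = free φ} x∈))

-- For a well-formed φ, the variables bound along a deepest branch of quantifiers form a
-- BoundChain (vars φ) (free φ) (qdepth φ).
record BoundChain (V F : List ℕ) (d : ℕ) : Set where
  field
    chain  : List ℕ
    unique : Unique chain
    ⊆vars  : ∀ {x} → x ∈ₗ chain → x ∈ₗ V
    ∉free  : ∀ {x} → x ∈ₗ chain → x ∉ₗ F
    depth≤ : d ≤ length chain

open BoundChain

empty-chain : {V F : List ℕ} → BoundChain V F 0
empty-chain = record { chain = [] ; unique = [] ; ⊆vars = λ () ; ∉free = λ () ; depth≤ = z≤n }

chain-weaken : {V V′ F F′ : List ℕ} {d d′ : ℕ} (C : BoundChain V F d) →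
               (∀ {x} → x ∈ₗ V → x ∈ₗ V′) → (∀ {x} → x ∈ₗ F′ → x ∈ₗ V → x ∈ₗ F) →
               d′ ≤ length (chain C) → BoundChain V′ F′ d′
chain-weaken C V⊆V′ F′∩V⊆F d′≤ = record
  { chain  = chain C
  ; unique = unique C
  ; ⊆vars  = λ x∈ → V⊆V′ (⊆vars C x∈)
  ; ∉free  = λ x∈ x∈F′ → ∉free C x∈ (F′∩V⊆F x∈F′ (⊆vars C x∈))
  ; depth≤ = d′≤
  }

chain-bind : {V F : List ℕ} {d i : ℕ} → i ∈ₗ V → i ∈ₗ F → BoundChain V F d →
             BoundChain V (filter (λ x → ¬? (x ≟ i)) F) (suc d)
chain-bind {F = F} {i = i} i∈V i∈F C = record
  { chain  = i ∷ chain C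
  ; unique = All.tabulate (λ x∈ i≡x → ∉free C x∈ (subst (_∈ₗ F) i≡x i∈F)) ∷ unique C
  ; ⊆vars  = λ { (here refl) → i∈V ; (there x∈) → ⊆vars C x∈ }
  ; ∉free  = λ { (here refl) x∈ → proj₂ (∈-filter⁻ (λ x → ¬? (x ≟ i)) {xs = F} x∈) refl
               ; (there x∈) x∈′ → ∉free C x∈ (proj₁ (∈-filter⁻ (λ x → ¬? (x ≟ i)) {xs = F} x∈′)) }
  ; depth≤ = s≤s (depth≤ C)
  }

bound-chain : ∀ φ → WellFormed φ → BoundChain (vars φ) (free φ) (qdepth φ)
bound-chain (sub _ _) _ = empty-chain
bound-chain (sing _)  _ = empty-chain
bound-chain (ind _)   _ = empty-chain
bound-chain (neg φ)   w = bound-chain φ w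
bound-chain (and φ χ) (wφ , wχ , φχ , χφ) = longer (bound-chain φ wφ) (bound-chain χ wχ)
  where
    longer : BoundChain (vars φ) (free φ) (qdepth φ) → BoundChain (vars χ) (free χ) (qdepth χ) →
             BoundChain (vars (and φ χ)) (free (and φ χ)) (qdepth (and φ χ))
    longer Cφ Cχ with ≤-total (length (chain Cχ)) (length (chain Cφ))
    ... | inj₁ χ≤φ = chain-weaken Cφ ∈-++⁺ˡ
          (λ x∈ x∈vφ → [ id , (λ x∈χ → χφ _ x∈χ x∈vφ) ]′ (∈-++⁻ (free φ) x∈))
          (⊔-lub (depth≤ Cφ) (≤-trans (depth≤ Cχ) χ≤φ))
    ... | inj₂ φ≤χ = chain-weaken Cχ (∈-++⁺ʳ (vars φ))
          (λ x∈ x∈vχ → [ (λ x∈φ → φχ _ x∈φ x∈vχ) , id ]′ (∈-++⁻ (free φ) x∈))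
          (⊔-lub (≤-trans (depth≤ Cφ) φ≤χ) (depth≤ Cχ))
bound-chain (ex i φ)  (w , i∈) = chain-bind (free⊆vars φ i∈) i∈ (bound-chain φ w)
bound-chain (all i φ) (w , i∈) = chain-bind (free⊆vars φ i∈) i∈ (bound-chain φ w)

qdepth≤numVars : ∀ φ → WellFormed φ → qdepth φ ≤ numVars φ
qdepth≤numVars φ w =
  ≤-trans (depth≤ C) (Unique-⊆⇒length≤ (unique C) (λ x∈ → ∈-deduplicate⁺ _≟_ (⊆vars C x∈)))
  where C = bound-chain φ w

module _ (k : ℕ) where

  sizes : Assignment n → Fin k → Fin 3
  sizes θ i = sizeClass ∣ θ (toℕ i) ∣

  atomicFact : Indep n → Assignment n → Fin k → Fin k ⊎ Fin 1 → Bool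
  atomicFact I θ i (inj₁ j) = does (θ (toℕ i) ⊆? θ (toℕ j))
  atomicFact I θ i (inj₂ _) = I (θ (toℕ i))

  atomicType : Indep n → Assignment n → Fin (g₁ k 0)
  atomicType I θ = combine (funToFin (sizes θ)) (encodeTable λ i j → atomicFact I θ i (splitAt k j))

  atomicType-agree : {I : Indep n} {θ : Assignment n} {I′ : Indep n′} {θ′ : Assignment n′} →
                     atomicType I θ ≡ atomicType I′ θ′ → (i j : Fin k) →
                     AtomsAgree I (θ (toℕ i)) (θ (toℕ j)) I′ (θ′ (toℕ i)) (θ′ (toℕ j))
  atomicType-agree {I = I} {θ} {I′} {θ′} e i j = record
    { size  = funToFin-injective (combine-injectiveˡ (funToFin (sizes θ)) _ (funToFin (sizes θ′)) _ e) i
    ; indep = fact≡ (k ↑ʳ 0F) (inj₂ 0F) (splitAt-↑ʳ k 1 0F)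
    ; incl  = fact≡ (j ↑ˡ 1) (inj₁ j) (splitAt-↑ˡ k j 1)
    }
    where
      table≡ = encodeTable-injective (combine-injectiveʳ (funToFin (sizes θ)) _ (funToFin (sizes θ′)) _ e) i
      fact≡ : ∀ c s → splitAt k c ≡ s → atomicFact I θ i s ≡ atomicFact I′ θ′ i s
      fact≡ c s refl = table≡ c

  atomicFact-⊕ : {I : Indep n} {J : Indep m} {θ : Assignment n} {ν : Assignment m} {ξ : Assignment (n + m)} →
                 ξ ≗ θ ++ₑ ν → ∀ i s → atomicFact (I ⊕ J) ξ i s ≡ atomicFact I θ i s ∧ atomicFact J ν i s
  atomicFact-⊕ {θ = θ} {ν} ξ≗ i (inj₁ j) rewrite ξ≗ (toℕ i) | ξ≗ (toℕ j) =
    ⊆?-++ (θ (toℕ i)) (θ (toℕ j)) (ν (toℕ i)) (ν (toℕ j))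
  atomicFact-⊕ {I = I} {J} {θ} {ν} ξ≗ i (inj₂ _) rewrite ξ≗ (toℕ i) =
    ⊕-++ I J (θ (toℕ i)) (ν (toℕ i))

  sizes-⊕ : {θ : Assignment n} {ν : Assignment m} {ξ : Assignment (n + m)} →
            ξ ≗ θ ++ₑ ν → ∀ i → sizes ξ i ≡ sizeClass (∣ θ (toℕ i) ∣ + ∣ ν (toℕ i) ∣)
  sizes-⊕ {θ = θ} {ν} ξ≗ i =
    trans (cong (sizeClass ∘ ∣_∣) (ξ≗ (toℕ i))) (cong sizeClass (∣++∣ (θ (toℕ i)) (ν (toℕ i))))

  atomicType-⊕ : {I : Indep n} {I′ : Indep n′} {J : Indep m}
                 {θ : Assignment n} {θ′ : Assignment n′} {ν : Assignment m}
                 {ξ : Assignment (n + m)} {ξ′ : Assignment (n′ + m)} →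
                 ξ ≗ θ ++ₑ ν → ξ′ ≗ θ′ ++ₑ ν → atomicType I θ ≡ atomicType I′ θ′ →
                 atomicType (I ⊕ J) ξ ≡ atomicType (I′ ⊕ J) ξ′
  atomicType-⊕ {I = I} {I′} {J} {θ} {θ′} {ν} {ξ} {ξ′} ξ≗ ξ′≗ e =
    cong₂ combine (funToFin-cong sizes≡) (encodeTable-cong λ i j → facts≡ i (splitAt k j))
    where
      open ≡-Reasoning
      sizes≡ : sizes ξ ≗ sizes ξ′
      sizes≡ i = begin
        sizes ξ i                                   ≡⟨ sizes-⊕ {θ = θ} {ν} ξ≗ i ⟩
        sizeClass (∣ θ (toℕ i) ∣ + ∣ ν (toℕ i) ∣)   ≡⟨ sizeClass-+ _ _ _ (AtomsAgree.size (atomicType-agree e i i)) ⟩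
        sizeClass (∣ θ′ (toℕ i) ∣ + ∣ ν (toℕ i) ∣)  ≡⟨ sizes-⊕ {θ = θ′} {ν} ξ′≗ i ⟨
        sizes ξ′ i                                  ∎
      fact≡ : ∀ i s → atomicFact I θ i s ≡ atomicFact I′ θ′ i s
      fact≡ i (inj₁ j) = AtomsAgree.incl (atomicType-agree e i j)
      fact≡ i (inj₂ _) = AtomsAgree.indep (atomicType-agree e i i)
      facts≡ : ∀ i s → atomicFact (I ⊕ J) ξ i s ≡ atomicFact (I′ ⊕ J) ξ′ i s
      facts≡ i s = begin
        atomicFact (I ⊕ J) ξ i s                    ≡⟨ atomicFact-⊕ ξ≗ i s ⟩
        atomicFact I θ i s ∧ atomicFact J ν i s     ≡⟨ cong (_∧ atomicFact J ν i s) (fact≡ i s) ⟩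
        atomicFact I′ θ′ i s ∧ atomicFact J ν i s   ≡⟨ atomicFact-⊕ ξ′≗ i s ⟨
        atomicFact (I′ ⊕ J) ξ′ i s                  ∎

  -- A quantifier with r + 1 rounds left binds slot r, so the depth-R type ignores the slots below R.
  type : (r : ℕ) → Indep n → Assignment n → Fin (g₁ k r)
  type zero    I θ = atomicType I θ
  type (suc r) I θ = encodeBits λ c → does (anySubset? λ Y → type r I (update θ r Y) ≟ᶠ c)

  type-realise : {I : Indep n} {θ : Assignment n} {I′ : Indep n′} {θ′ : Assignment n′} →
                 type (suc r) I θ ≡ type (suc r) I′ θ′ → ∀ Y →
                 ∃[ Y′ ] type r I′ (update θ′ r Y′) ≡ type r I (update θ r Y)
  type-realise {r = r} {I = I} {θ} e Y =
    to (does-≡⇒⇔ (anySubset? _) (anySubset? _) (encodeBits-injective e (type r I (update θ r Y)))) (Y , refl)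

  type-agree : {I : Indep n} {θ : Assignment n} {I′ : Indep n′} {θ′ : Assignment n′} →
               type R I θ ≡ type R I′ θ′ → R ≤ a → a < k → R ≤ b → b < k →
               AtomsAgree I (θ a) (θ b) I′ (θ′ a) (θ′ b)
  type-agree {R = zero} {I = I} {θ} {I′} {θ′} e _ a<k _ b<k =
    subst₂ (λ a b → AtomsAgree I (θ a) (θ b) I′ (θ′ a) (θ′ b)) (toℕ-fromℕ< a<k) (toℕ-fromℕ< b<k)
      (atomicType-agree e (fromℕ< a<k) (fromℕ< b<k))
  -- Descend by realising a reassignment of slot r on both sides; the slots a, b > r are untouched.
  type-agree {R = suc r} {θ = θ} {θ′ = θ′} e r<a a<k r<b b<k
    with Y′ , e′ ← type-realise {r = r} e ∅
    rewrite sym (update-other θ ∅ (>⇒≢ r<a)) | sym (update-other θ ∅ (>⇒≢ r<b))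
          | sym (update-other θ′ Y′ (>⇒≢ r<a)) | sym (update-other θ′ Y′ (>⇒≢ r<b)) =
    type-agree {R = r} (sym e′) (<⇒≤ r<a) a<k (<⇒≤ r<b) b<k

  type-⊕ : ∀ r {I : Indep n} {I′ : Indep n′} {J : Indep m}
           {θ : Assignment n} {θ′ : Assignment n′} {ν : Assignment m}
           {ξ : Assignment (n + m)} {ξ′ : Assignment (n′ + m)} →
           ξ ≗ θ ++ₑ ν → ξ′ ≗ θ′ ++ₑ ν → type r I θ ≡ type r I′ θ′ → type r (I ⊕ J) ξ ≡ type r (I′ ⊕ J) ξ′

  reachable-⊕ : ∀ r {I : Indep n} {I′ : Indep n′} {J : Indep m}
                {θ : Assignment n} {θ′ : Assignment n′} {ν : Assignment m}
                {ξ : Assignment (n + m)} {ξ′ : Assignment (n′ + m)} {c : Fin (g₁ k r)} →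
                type (suc r) I θ ≡ type (suc r) I′ θ′ → ξ ≗ θ ++ₑ ν → ξ′ ≗ θ′ ++ₑ ν →
                ∃[ Y ] type r (I ⊕ J) (update ξ r Y) ≡ c → ∃[ Y′ ] type r (I′ ⊕ J) (update ξ′ r Y′) ≡ c

  type-⊕ zero {J = J} ξ≗ ξ′≗ e = atomicType-⊕ {J = J} ξ≗ ξ′≗ e
  type-⊕ (suc r) {I} {I′} {J} {ξ = ξ} {ξ′} ξ≗ ξ′≗ e = encodeBits-cong λ c →
    does-⇔ (mk⇔ (reachable-⊕ r {J = J} e ξ≗ ξ′≗) (reachable-⊕ r {J = J} (sym e) ξ′≗ ξ≗))
      (anySubset? λ Y → type r (I ⊕ J) (update ξ r Y) ≟ᶠ c)
      (anySubset? λ Y → type r (I′ ⊕ J) (update ξ′ r Y) ≟ᶠ c)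

  -- Split the witness across the two summands and realise its first half over I′.
  reachable-⊕ {n = n} r {J = J} e ξ≗ ξ′≗ (Y , reached) =
    let Y₁′ , e₁ = type-realise {r = r} e (take n Y)
    in  Y₁′ ++ drop n Y
      , trans (sym (type-⊕ r {J = J} (update-++ₑ ξ≗ (sym (take++drop≡id n Y))) (update-++ₑ ξ′≗ refl) (sym e₁)))
              reached

  record Reads (R : ℕ) (V : List ℕ) (σ : ℕ → ℕ) (θ ρ : Assignment n) : Set where
    constructor reads
    field
      slot : ∀ {x} → x ∈ₗ V → R ≤ σ x × σ x < k × ρ x ≡ θ (σ x)

  open Reads

  closed-reads : {V : List ℕ} {σ : ℕ → ℕ} {θ ρ : Assignment n} → V ≡ [] → Reads R V σ θ ρ
  closed-reads refl = reads λ ()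

  reads-agree : {V : List ℕ} {σ : ℕ → ℕ} {I : Indep n} {θ ρ : Assignment n}
                {I′ : Indep n′} {θ′ ρ′ : Assignment n′} {x y : ℕ} →
                type R I θ ≡ type R I′ θ′ → Reads R V σ θ ρ → Reads R V σ θ′ ρ′ →
                x ∈ₗ V → y ∈ₗ V → AtomsAgree I (ρ x) (ρ y) I′ (ρ′ x) (ρ′ y)
  reads-agree {R = R} e rd rd′ x∈ y∈
    with R≤σx , σx<k , ρx ← slot rd x∈ | R≤σy , σy<k , ρy ← slot rd y∈
       | _ , _ , ρ′x ← slot rd′ x∈ | _ , _ , ρ′y ← slot rd′ y∈
    rewrite ρx | ρy | ρ′x | ρ′y = type-agree {R = R} e R≤σx σx<k R≤σy σy<k

  reads-++ : {V W : List ℕ} {σ : ℕ → ℕ} {θ ρ : Assignment n} →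
             Reads R (V ++ₗ W) σ θ ρ → Reads R V σ θ ρ × Reads R W σ θ ρ
  reads-++ {V = V} rd = reads (λ x∈ → slot rd (∈-++⁺ˡ x∈)) , reads (λ x∈ → slot rd (∈-++⁺ʳ V x∈))

  reads-rebind : {i : ℕ} {φ : Formula} {σ : ℕ → ℕ} {θ ρ : Assignment n} {Y : Subset n} → r < k →
                 Reads (suc r) (free (ex i φ)) σ θ ρ →
                 Reads r (free φ) (σ [ i ↦ r ]) (update θ r Y) (update ρ i Y)
  reads-rebind {r = r} {i} {φ} {σ} {θ} {ρ} {Y} r<k rd = reads rebound
    where
      rebound : ∀ {x} → x ∈ₗ free φ →
                r ≤ (σ [ i ↦ r ]) x × (σ [ i ↦ r ]) x < k × update ρ i Y x ≡ update θ r Y ((σ [ i ↦ r ]) x)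
      rebound {x} x∈ with x ≟ i
      ... | yes refl = ≤-refl , r<k , sym (update-same θ r Y)
      ... | no x≢i with r<σx , σx<k , ρx ← slot rd (∈-filter⁺ (λ x → ¬? (x ≟ i)) x∈ x≢i) =
        <⇒≤ r<σx , σx<k , trans ρx (sym (update-other θ Y (>⇒≢ r<σx)))

  Sat-resp-type : ∀ φ {I : Indep n} {θ ρ : Assignment n} {I′ : Indep n′} {θ′ ρ′ : Assignment n′} {σ : ℕ → ℕ} →
                  qdepth φ ≤ R → R ≤ k → type R I θ ≡ type R I′ θ′ →
                  Reads R (free φ) σ θ ρ → Reads R (free φ) σ θ′ ρ′ →
                  Sat n I ρ φ ⇔ Sat n′ I′ ρ′ φ

  Sat-resp-rebind : ∀ φ {i : ℕ} {I : Indep n} {θ ρ : Assignment n} {I′ : Indep n′} {θ′ ρ′ : Assignment n′}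
                    {σ : ℕ → ℕ} {Y : Subset n} {Y′ : Subset n′} →
                    qdepth φ ≤ r → r < k →
                    Reads (suc r) (free (ex i φ)) σ θ ρ → Reads (suc r) (free (ex i φ)) σ θ′ ρ′ →
                    type r I (update θ r Y) ≡ type r I′ (update θ′ r Y′) →
                    Sat n I (update ρ i Y) φ ⇔ Sat n′ I′ (update ρ′ i Y′) φ
  Sat-resp-rebind {r = r} φ d r<k rd rd′ e =
    Sat-resp-type φ d (<⇒≤ r<k) e (reads-rebind {r = r} {φ = φ} r<k rd) (reads-rebind {r = r} {φ = φ} r<k rd′)

  Sat-resp-type {R = R} (sub i j) _ _ e rd rd′ =
    does-≡⇒⇔ (_ ⊆? _) (_ ⊆? _) (AtomsAgree.incl (reads-agree {R = R} e rd rd′ (here refl) (there (here refl))))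
  Sat-resp-type {R = R} (sing i) _ _ e rd rd′ = mk⇔ (sizeClass-≡1 _ _ size) (sizeClass-≡1 _ _ (sym size))
    where size = AtomsAgree.size (reads-agree {R = R} e rd rd′ (here refl) (here refl))
  Sat-resp-type {R = R} (ind i) _ _ e rd rd′ = mk⇔ (trans (sym indep)) (trans indep)
    where indep = AtomsAgree.indep (reads-agree {R = R} e rd rd′ (here refl) (here refl))
  Sat-resp-type (neg φ) d R≤k e rd rd′ = ¬-cong-⇔ (Sat-resp-type φ d R≤k e rd rd′)
  Sat-resp-type (and φ χ) d R≤k e rd rd′ =
        Sat-resp-type φ (m⊔n≤o⇒m≤o _ _ d) R≤k e (proj₁ (reads-++ rd)) (proj₁ (reads-++ rd′))
    ×-⇔ Sat-resp-type χ (m⊔n≤o⇒n≤o _ _ d) R≤k e (proj₂ (reads-++ rd)) (proj₂ (reads-++ rd′))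
  Sat-resp-type {R = suc r} (ex i φ) (s≤s d) r<k e rd rd′ = mk⇔
    (λ (Y , s) → let Y′ , e′ = type-realise {r = r} e Y in Y′ , to (Sat-resp-rebind φ d r<k rd rd′ (sym e′)) s)
    (λ (Y′ , s) → let Y , e′ = type-realise {r = r} (sym e) Y′ in Y , from (Sat-resp-rebind φ d r<k rd rd′ e′) s)
  Sat-resp-type {R = suc r} (all i φ) (s≤s d) r<k e rd rd′ = mk⇔
    (λ f Y′ → let Y , e′ = type-realise {r = r} (sym e) Y′ in to (Sat-resp-rebind φ d r<k rd rd′ e′) (f Y))
    (λ g Y → let Y′ , e′ = type-realise {r = r} e Y in from (Sat-resp-rebind φ d r<k rd rd′ (sym e′)) (g Y′))

lemma1p3 : (k : ℕ) → 1 ≤ k →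
  Σ ℕ λ N → (N ≤ f₁ k) ×
  Σ ((n : ℕ) → (Subset n → Bool) → Fin N) λ block →
    (ψ : Formula) → IsSentence ψ → numVars ψ ≡ k →
    (n : ℕ) (I : Subset n → Bool) → IsMatroid n I →
    (n′ : ℕ) (I′ : Subset n′ → Bool) → IsMatroid n′ I′ →
    block n I ≡ block n′ I′ →
    (m : ℕ) (J : Subset m → Bool) → IsMatroid m J →
    (Models (n + m) (I ⊕ J) ψ ⇔ Models (n′ + m) (I′ ⊕ J) ψ)
lemma1p3 k _ = f₁ k , ≤-refl , block , λ ψ (wf , closed) numVars≡k n I _ n′ I′ _ sameBlock m J _ →
  Sat-resp-type k ψ {σ = id} (subst (qdepth ψ ≤_) numVars≡k (qdepth≤numVars ψ wf)) ≤-refl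
    (type-⊕ k k {J = J} {ν = λ _ → ∅} (λ _ → refl) (λ _ → refl) sameBlock)
    (closed-reads k closed) (closed-reads k closed)
  where
    block : (n : ℕ) → Indep n → Fin (f₁ k)
    block n I = type k k I (λ _ → ∅)
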